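{- Let $A$ and $B$ be finite sets with $A\cap B\neq\emptyset$ and $A\setminus B\neq\emptyset$. Let $G$ be a permutation group on $A\cup B$ whose restriction to $A$ is 2-transitive and which fixes every point of $B\setminus A$, and let $\beta$ be a cycle whose support is exactly $B$. Then the permutation group generated by $G$ and $\beta$ acts 2-transitively on $A\cup B$.
   Context: A permutation group $G$ on a set $X$ is 2-transitive on $X$ if for all $x\neq y$ and $w\neq z$ in $X$ there is $\pi\in G$ with $\pi(x)=w$ and $\pi(y)=z$. Saying the restriction of $G$ to $A$ is 2-transitive means $G$ preserves $A$ and the induced action on $A$ is 2-transitive. -}

module Defs where

open import Data.Nat using (ℕ; zero; suc)
open import Data.Fin using (Fin)
open import Data.Fin.Subset using (Subset; _∈_; _∉_)
open import Data.Fin.Permutation using (Permutation′; _⟨$⟩ʳ_; _∘ₚ_; flip; id)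
open import Data.Product using (Σ; _×_; _,_)
open import Relation.Binary.PropositionalEquality using (_≡_; _≢_)

record IsPermGroup {n : ℕ} (G : Permutation′ n → Set) : Set where
  field
    has-id  : G id
    has-∘   : ∀ {g h} → G g → G h → G (g ∘ₚ h)
    has-inv : ∀ {g} → G g → G (flip g)

data Generated {n : ℕ} (G : Permutation′ n → Set) (β : Permutation′ n)
       : Permutation′ n → Set where
  gen-G   : ∀ {g} → G g → Generated G β g
  gen-β   : Generated G β β
  gen-id  : Generated G β id
  gen-∘   : ∀ {g h} → Generated G β g → Generated G β h → Generated G β (g ∘ₚ h)
  gen-inv : ∀ {g} → Generated G β g → Generated G β (flip g)

Preserves : {n : ℕ} → (Permutation′ n → Set) → Subset n → Set
Preserves G A = ∀ g → G g → ∀ x → (x ∈ A → g ⟨$⟩ʳ x ∈ A) × (g ⟨$⟩ʳ x ∈ A → x ∈ A)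

TwoTransitiveOn : {n : ℕ} → (Permutation′ n → Set) → Subset n → Set
TwoTransitiveOn G A =
  ∀ x y w z → x ∈ A → y ∈ A → w ∈ A → z ∈ A → x ≢ y → w ≢ z →
  Σ _ λ g → G g × (g ⟨$⟩ʳ x ≡ w) × (g ⟨$⟩ʳ y ≡ z)

TwoTransitive : {n : ℕ} → (Permutation′ n → Set) → Set
TwoTransitive {n} G =
  ∀ (x y w z : Fin n) → x ≢ y → w ≢ z →
  Σ _ λ g → G g × (g ⟨$⟩ʳ x ≡ w) × (g ⟨$⟩ʳ y ≡ z)

iterate : {n : ℕ} → Permutation′ n → ℕ → Fin n → Fin n
iterate β zero x = x
iterate β (suc k) x = β ⟨$⟩ʳ iterate β k x

InSupport : {n : ℕ} → Permutation′ n → Fin n → Set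
InSupport β x = β ⟨$⟩ʳ x ≢ x

IsCycleWithSupport : {n : ℕ} → Permutation′ n → Subset n → Set
IsCycleWithSupport {n} β B =
  (∀ (x : Fin n) → (x ∈ B → InSupport β x) × (InSupport β x → x ∈ B)) ×
  (∀ (x y : Fin n) → x ∈ B → y ∈ B → Σ ℕ λ k → iterate β k x ≡ y)

-- An ordered pair of distinct points that the generated group can move into A
-- can be sent anywhere, by conjugating the 2-transitive action of G on A.  So it
-- suffices to move every pair into A.  A point x ∈ B ∖ A is fixed by G, and some
-- power of β sends it to a point c ∈ A ∩ B while fixing a point d ∈ A ∖ B; first
-- moving the partner of x onto d with G therefore lands the pair in A.  Two points
-- outside A are handled by first moving one of them to c with a power of β.
module Submission where

open import Defs
open import Data.Nat using (ℕ; zero; suc)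
open import Data.Fin using (Fin)
open import Data.Fin.Properties using (_≟_)
open import Data.Fin.Subset using (Subset; _∈_; _∉_)
open import Data.Fin.Subset.Properties using (_∈?_)
open import Data.Fin.Permutation using (Permutation′; _⟨$⟩ʳ_; _∘ₚ_; flip; id; inverseˡ)
open import Data.Product using (Σ; _×_; _,_; proj₁; proj₂)
open import Data.Sum using (_⊎_; inj₁; inj₂)
open import Data.Empty using (⊥-elim)
open import Function.Bundles using (Injection)
open import Function.Properties.Inverse using (↔⇒↣)
open import Relation.Nullary using (yes; no)
open import Relation.Binary.PropositionalEquality
  using (_≡_; _≢_; refl; sym; trans; cong; subst; module ≡-Reasoning)

private
  variable
    n : ℕ

⟨$⟩ʳ-injective : (π : Permutation′ n) {x y : Fin n} → π ⟨$⟩ʳ x ≡ π ⟨$⟩ʳ y → x ≡ y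
⟨$⟩ʳ-injective π = Injection.injective (↔⇒↣ π)

power : Permutation′ n → ℕ → Permutation′ n
power β zero    = id
power β (suc k) = power β k ∘ₚ β

power-⟨$⟩ʳ : (β : Permutation′ n) (k : ℕ) (x : Fin n) → power β k ⟨$⟩ʳ x ≡ iterate β k x
power-⟨$⟩ʳ β zero    x = refl
power-⟨$⟩ʳ β (suc k) x = cong (β ⟨$⟩ʳ_) (power-⟨$⟩ʳ β k x)

iterate-fixed : (β : Permutation′ n) {x : Fin n} → β ⟨$⟩ʳ x ≡ x → ∀ k → iterate β k x ≡ x
iterate-fixed β βx≡x zero    = refl
iterate-fixed β βx≡x (suc k) = trans (cong (β ⟨$⟩ʳ_) (iterate-fixed β βx≡x k)) βx≡x

power-∈ : {H : Permutation′ n → Set} → IsPermGroup H →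
          ∀ {β} → H β → ∀ k → H (power β k)
power-∈ isH Hβ zero    = IsPermGroup.has-id isH
power-∈ isH Hβ (suc k) = IsPermGroup.has-∘ isH (power-∈ isH Hβ k) Hβ

Generated-isPermGroup : (G : Permutation′ n → Set) (β : Permutation′ n) →
                        IsPermGroup (Generated G β)
Generated-isPermGroup G β = record { has-id = gen-id ; has-∘ = gen-∘ ; has-inv = gen-inv }

TransitiveOn : (Permutation′ n → Set) → Subset n → Set
TransitiveOn G A = ∀ x y → x ∈ A → y ∈ A → Σ _ λ g → G g × g ⟨$⟩ʳ x ≡ y

TwoTransitiveOn-mono : {G H : Permutation′ n → Set} {A : Subset n} →
                       (∀ {g} → G g → H g) → TwoTransitiveOn G A → TwoTransitiveOn H A
TwoTransitiveOn-mono G⊆H tt x y w z xA yA wA zA x≢y w≢z with tt x y w z xA yA wA zA x≢y w≢z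
... | g , Gg , gx≡w , gy≡z = g , G⊆H Gg , gx≡w , gy≡z

another-point : {A : Subset n} {c d : Fin n} → c ∈ A → d ∈ A → c ≢ d →
                ∀ y → Σ (Fin n) λ o → o ∈ A × y ≢ o
another-point {c = c} {d} cA dA c≢d y with y ≟ c
... | yes refl = d , dA , c≢d
... | no  y≢c  = c , cA , y≢c

transitiveOn-twoTransitiveOn : {G : Permutation′ n → Set} {A : Subset n} {c d : Fin n} →
                               c ∈ A → d ∈ A → c ≢ d →
                               TwoTransitiveOn G A → TransitiveOn G A
transitiveOn-twoTransitiveOn cA dA c≢d tt x y xA yA
  with another-point cA dA c≢d x | another-point cA dA c≢d y
... | o , oA , x≢o | o′ , o′A , y≢o′ with tt x o y o′ xA oA yA o′A x≢o y≢o′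
... | g , Gg , gx≡y , _ = g , Gg , gx≡y

MovesPairInto : (Permutation′ n → Set) → Subset n → Fin n → Fin n → Set
MovesPairInto H A x y = Σ _ λ h → H h × h ⟨$⟩ʳ x ∈ A × h ⟨$⟩ʳ y ∈ A

MovesPairInto-swap : {H : Permutation′ n → Set} {A : Subset n} {x y : Fin n} →
                     MovesPairInto H A x y → MovesPairInto H A y x
MovesPairInto-swap (h , Hh , hxA , hyA) = h , Hh , hyA , hxA

-- Note that h ∘ₚ h′ applies h first.
MovesPairInto-after : {H : Permutation′ n → Set} {A : Subset n} → IsPermGroup H →
                      ∀ {h x y} → H h →
                      MovesPairInto H A (h ⟨$⟩ʳ x) (h ⟨$⟩ʳ y) → MovesPairInto H A x y
MovesPairInto-after isH {h} Hh (h′ , Hh′ , hxA , hyA) =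
  h ∘ₚ h′ , IsPermGroup.has-∘ isH Hh Hh′ , hxA , hyA

twoTransitive-movesPairInto : {H : Permutation′ n → Set} {A : Subset n} →
                              IsPermGroup H → TwoTransitiveOn H A →
                              (∀ x y → x ≢ y → MovesPairInto H A x y) → TwoTransitive H
twoTransitive-movesPairInto isH tt moves x y w z x≢y w≢z
  with moves x y x≢y | moves w z w≢z
... | h₁ , Hh₁ , h₁xA , h₁yA | h₂ , Hh₂ , h₂wA , h₂zA
  with tt _ _ _ _ h₁xA h₁yA h₂wA h₂zA
          (λ eq → x≢y (⟨$⟩ʳ-injective h₁ eq)) (λ eq → w≢z (⟨$⟩ʳ-injective h₂ eq))
... | g , Hg , gx≡h₂w , gy≡h₂z =
  h₁ ∘ₚ g ∘ₚ flip h₂ , has-∘ Hh₁ (has-∘ Hg (has-inv Hh₂)) ,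
  trans (cong (flip h₂ ⟨$⟩ʳ_) gx≡h₂w) (inverseˡ h₂) ,
  trans (cong (flip h₂ ⟨$⟩ʳ_) gy≡h₂z) (inverseˡ h₂)
  where open IsPermGroup isH

module CycleExtension
    (A B : Subset n)
    (A∪B-covers : ∀ (x : Fin n) → x ∈ A ⊎ x ∈ B)
    {c : Fin n} (cA : c ∈ A) (cB : c ∈ B)
    {d : Fin n} (dA : d ∈ A) (d∉B : d ∉ B)
    (G : Permutation′ n → Set) (tt : TwoTransitiveOn G A)
    (fixes-B∖A : ∀ g → G g → ∀ (x : Fin n) → x ∈ B → x ∉ A → g ⟨$⟩ʳ x ≡ x)
    (β : Permutation′ n) (cycle : IsCycleWithSupport β B) where

  H : Permutation′ n → Set
  H = Generated G β

  isH : IsPermGroup H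
  isH = Generated-isPermGroup G β

  ∉A⇒∈B : ∀ {x} → x ∉ A → x ∈ B
  ∉A⇒∈B {x} x∉A with A∪B-covers x
  ... | inj₁ xA = ⊥-elim (x∉A xA)
  ... | inj₂ xB = xB

  c≢d : c ≢ d
  c≢d refl = d∉B cB

  β-fixes-d : β ⟨$⟩ʳ d ≡ d
  β-fixes-d with β ⟨$⟩ʳ d ≟ d
  ... | yes βd≡d = βd≡d
  ... | no  βd≢d = ⊥-elim (d∉B (proj₂ (proj₁ cycle d) βd≢d))

  power-to-c : ∀ {x} → x ∉ A → Σ ℕ λ k → power β k ⟨$⟩ʳ x ≡ c
  power-to-c {x} x∉A with proj₂ cycle x c (∉A⇒∈B x∉A) cB
  ... | k , βᵏx≡c = k , trans (power-⟨$⟩ʳ β k x) βᵏx≡c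

  moves-outside-inside : ∀ {x y} → x ∉ A → y ∈ A → MovesPairInto H A x y
  moves-outside-inside {x} {y} x∉A yA
    with transitiveOn-twoTransitiveOn cA dA c≢d tt y d yA dA | power-to-c x∉A
  ... | g , Gg , gy≡d | k , βᵏx≡c =
    g ∘ₚ power β k , has-∘ (gen-G Gg) (power-∈ isH gen-β k) ,
    subst (_∈ A) (sym gx↦c) cA , subst (_∈ A) (sym gy↦d) dA
    where
    open IsPermGroup isH
    open ≡-Reasoning
    gx↦c : power β k ⟨$⟩ʳ (g ⟨$⟩ʳ x) ≡ c
    gx↦c = begin
      power β k ⟨$⟩ʳ (g ⟨$⟩ʳ x) ≡⟨ cong (power β k ⟨$⟩ʳ_) (fixes-B∖A g Gg x (∉A⇒∈B x∉A) x∉A) ⟩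
      power β k ⟨$⟩ʳ x          ≡⟨ βᵏx≡c ⟩
      c                         ∎
    gy↦d : power β k ⟨$⟩ʳ (g ⟨$⟩ʳ y) ≡ d
    gy↦d = begin
      power β k ⟨$⟩ʳ (g ⟨$⟩ʳ y) ≡⟨ cong (power β k ⟨$⟩ʳ_) gy≡d ⟩
      power β k ⟨$⟩ʳ d          ≡⟨ power-⟨$⟩ʳ β k d ⟩
      iterate β k d             ≡⟨ iterate-fixed β β-fixes-d k ⟩
      d                         ∎

  moves-into-A : ∀ x y → MovesPairInto H A x y
  moves-into-A x y with x ∈? A | y ∈? A
  ... | yes xA  | yes yA  = id , gen-id , xA , yA
  ... | no  x∉A | yes yA  = moves-outside-inside x∉A yA
  ... | yes xA  | no  y∉A = MovesPairInto-swap (moves-outside-inside y∉A xA)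
  ... | no  x∉A | no  _   with power-to-c x∉A
  ...   | k , βᵏx≡c = MovesPairInto-after isH (power-∈ isH gen-β k)
                        (subst (λ z → MovesPairInto H A z (power β k ⟨$⟩ʳ y)) (sym βᵏx≡c)
                          (moves-with-c (power β k ⟨$⟩ʳ y)))
    where
    moves-with-c : ∀ z → MovesPairInto H A c z
    moves-with-c z with z ∈? A
    ... | yes zA  = id , gen-id , cA , zA
    ... | no  z∉A = MovesPairInto-swap (moves-outside-inside z∉A cA)

  twoTransitive : TwoTransitive H
  twoTransitive = twoTransitive-movesPairInto isH (TwoTransitiveOn-mono gen-G tt)
                    (λ x y _ → moves-into-A x y)

lemma6 : (n : ℕ) (A B : Subset n)
    → (∀ (x : Fin n) → x ∈ A ⊎ x ∈ B)
    → Σ (Fin n) (λ x → x ∈ A × x ∈ B)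
    → Σ (Fin n) (λ x → x ∈ A × x ∉ B)
    → (G : Permutation′ n → Set) → IsPermGroup G
    → Preserves G A → TwoTransitiveOn G A
    → (∀ g → G g → ∀ (x : Fin n) → x ∈ B → x ∉ A → g ⟨$⟩ʳ x ≡ x)
    → (β : Permutation′ n) → IsCycleWithSupport β B
    → TwoTransitive (Generated G β)
lemma6 n A B covers (c , cA , cB) (d , dA , d∉B) G _ _ tt fixes β cycle =
  CycleExtension.twoTransitive A B covers cA cB dA d∉B G tt fixes β cycle
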